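{- For every positive integer $\omega$, there exists a split graph $G$ with $\omega(G)=\omega$ such that $\overrightarrow{\chi}(G)=2\omega-2$.
   Context: An orientation $D$ of a graph $G$ replaces each edge by exactly one of its two possible arcs; $d^-_D(v)$ is the indegree of $v$. $D$ is proper if adjacent vertices have distinct indegrees; a $k$-orientation has maximum indegree at most $k$. $\overrightarrow{\chi}(G)$ is the minimum $k$ such that $G$ admits a proper $k$-orientation; $\omega(G)$ is the clique number. A split graph is a graph whose vertex set can be partitioned into a clique and an independent set. -}

module Defs where

open import Data.Nat using (ℕ; _≤_; _<_; suc)
open import Data.Fin using (Fin)
open import Data.Bool using (Bool; true; false; T; _xor_)
open import Data.List using (List; filter; length; allFin)
open import Data.Product using (Σ; _×_; ∃)
open import Data.Sum using (_⊎_)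
open import Relation.Nullary using (¬_)
open import Relation.Binary.PropositionalEquality using (_≡_; _≢_)
open import Function.Definitions using (Injective)
open import Data.Bool.Properties using (T?)

record Graph : Set where
  field
    n     : ℕ
    adj   : Fin n → Fin n → Bool
    sym   : ∀ u v → adj u v ≡ adj v u
    irrefl : ∀ v → adj v v ≡ false
open Graph public

IsClique : (G : Graph) (k : ℕ) → (Fin k → Fin (n G)) → Set
IsClique G k f = Injective _≡_ _≡_ f × (∀ i j → i ≢ j → T (adj G (f i) (f j)))

HasClique : Graph → ℕ → Set
HasClique G k = Σ (Fin k → Fin (n G)) (IsClique G k)

CliqueNumber : Graph → ℕ → Set
CliqueNumber G w = HasClique G w × ¬ HasClique G (suc w)

IsSplit : Graph → Set
IsSplit G = Σ (Fin (n G) → Bool) λ inK →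
    (∀ u v → u ≢ v → T (inK u) → T (inK v) → T (adj G u v))
  × (∀ u v → inK u ≡ false → inK v ≡ false → adj G u v ≡ false)

record Orientation (G : Graph) : Set where
  field
    arc      : Fin (n G) → Fin (n G) → Bool
    arc⇒adj  : ∀ u v → T (arc u v) → T (adj G u v)
    oneArc   : ∀ u v → T (adj G u v) → T (arc u v xor arc v u)
open Orientation public

indeg : {G : Graph} → Orientation G → Fin (n G) → ℕ
indeg D v = length (filter (λ u → T? (arc D u v)) (allFin _))

IsProperKOrientation : (G : Graph) → ℕ → Orientation G → Set
IsProperKOrientation G k D =
    (∀ u v → T (adj G u v) → indeg D u ≢ indeg D v)
  × (∀ v → indeg D v ≤ k)

HasProperKOrientation : Graph → ℕ → Set
HasProperKOrientation G k = Σ (Orientation G) (IsProperKOrientation G k)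

ProperOrientationNumber : Graph → ℕ → Set
ProperOrientationNumber G k =
  HasProperKOrientation G k × (∀ j → j < k → ¬ HasProperKOrientation G j)

-- The witness for ω = m + 1 is the split graph with clique K = {v₀, …, vₘ},
-- m boosters adjacent to v₁, …, vₘ, and, for every interval I of at most m
-- consecutive clique vertices, N = 2mω + 1 copies of a vertex with neighbourhood I.
--
-- Upper bound: orient K transitively (vᵢ → vⱼ for i < j) and every other edge
-- out of the booster or into the copy. Then v₀ has indegree 0, vᵢ (i ≥ 1) has
-- i + m ∈ [m + 1, 2m], boosters have 0 and a copy on I has |I| ∈ [1, m], so the
-- orientation is proper with maximum indegree 2m = 2ω − 2.
--
-- Lower bound: let D be proper with maximum indegree j < 2m. If some u ∈ K had
-- indegree t ∈ [1, m], every copy on an interval I ∋ u of length t would have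
-- degree t and be adjacent to u, hence an out-arc into I; as N > ωj, some clique
-- vertex would then receive more than j arcs. So the indegrees on K lie in
-- {0} ∪ [m + 1, 2m − 1], a set of m values, for m + 1 pairwise adjacent vertices.
--
-- The clique number is ω because sending every vertex outside K to a clique vertex
-- it misses is a proper ω-colouring.

module Submission where

open import Defs
open import Data.Bool using (Bool; true; false; T; _∧_; _∨_; _xor_)
open import Data.Bool.Properties using (T?; T-∧; T-∨; ∨-comm)
open import Data.Empty using (⊥; ⊥-elim)
open import Data.Fin using (Fin; zero; suc; toℕ; fromℕ; fromℕ<; splitAt; remQuot; quotRem)
open import Data.Fin.Properties
  using (+↔⊎; *↔×; toℕ<n; toℕ≤pred[n]; toℕ-fromℕ; toℕ-fromℕ<; toℕ-injective; pigeonhole)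
import Data.Fin.Properties as Finₚ
open import Data.List using (length; filter; tabulate)
open import Data.Nat
  using (ℕ; zero; suc; _+_; _*_; _∸_; _≤_; _<_; _≤ᵇ_; _<ᵇ_; z≤n; s≤s; z<s; _≤?_; _<?_; _≟_)
open import Data.Nat.Properties
  using ( +-0-commutativeMonoid; +-assoc; +-comm; +-identityʳ; *-suc; ≤-refl; ≤-reflexive; ≤-trans
        ; <-irrefl; <-asym; <-cmp; ≤-<-trans; <-≤-trans; <⇒≤; <⇒≢; ≰⇒>; ≮⇒≥; n<1+n; n≮0; n≢0⇒n>0
        ; m≤n⇒m≤1+n; m≤m+n; m≤n+m; m<m+n; m<n+m; +-mono-≤; +-monoˡ-≤; +-monoˡ-<; *-monoʳ-≤
        ; m∸n+n≡m; m≤n+o⇒m∸n≤o; m<n+o⇒m∸n<o; m<n⇒0<n∸m; ∸-cancelʳ-≡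
        ; <ᵇ⇒<; <⇒<ᵇ; ≤ᵇ⇒≤; ≤⇒≤ᵇ; module ≤-Reasoning )
open import Data.Product using (Σ; _×_; _,_; proj₂; ∃-syntax; ∃₂)
import Data.Product as Product
open import Data.Product.Function.NonDependent.Propositional using (_×-↔_)
open import Data.Sum using (_⊎_; inj₁; inj₂)
import Data.Sum as Sum
open import Data.Sum.Function.Propositional using (_⊎-↔_)
open import Data.Sum.Properties using (inj₁-injective)
open import Function using (_∘_; id)
open import Function.Bundles using (_↔_; Inverse; Equivalence)
open import Function.Properties.Inverse using (↔-refl; ↔-trans)
open import Relation.Binary.Definitions using (tri<; tri≈; tri>)
open import Relation.Binary.PropositionalEquality
  using (_≡_; _≢_; refl; cong; cong₂; trans; subst; subst₂; ≢-sym; module ≡-Reasoning)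
import Relation.Binary.PropositionalEquality as ≡
open import Relation.Nullary using (¬_; yes; no)
open import Algebra.Properties.CommutativeMonoid.Sum +-0-commutativeMonoid
  using (sum; sum-syntax; ∑-comm; ∑-distrib-+; sum-cong-≗; sum-replicate-zero)

indicator : Bool → ℕ
indicator false = 0
indicator true  = 1

count : ∀ {k} → (Fin k → Bool) → ℕ
count p = sum (indicator ∘ p)

∑-zero : ∀ {k} {f : Fin k → ℕ} → (∀ i → f i ≡ 0) → sum f ≡ 0
∑-zero {k} f≡0 = trans (sum-cong-≗ f≡0) (sum-replicate-zero k)

∑-mono-≤ : ∀ {k} {f g : Fin k → ℕ} → (∀ i → f i ≤ g i) → sum f ≤ sum g
∑-mono-≤ {zero}  f≤g = z≤n
∑-mono-≤ {suc k} f≤g = +-mono-≤ (f≤g zero) (∑-mono-≤ (f≤g ∘ suc))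

∑-≤-* : ∀ {k b} {f : Fin k → ℕ} → (∀ i → f i ≤ b) → sum f ≤ k * b
∑-≤-* {zero}  f≤b = z≤n
∑-≤-* {suc k} f≤b = +-mono-≤ (f≤b zero) (∑-≤-* (f≤b ∘ suc))

term≤∑ : ∀ {k} (f : Fin k → ℕ) i → f i ≤ sum f
term≤∑ f zero    = m≤m+n _ _
term≤∑ f (suc i) = ≤-trans (term≤∑ (f ∘ suc) i) (m≤n+m _ _)

∑-splitAt : ∀ a {b} (h : Fin a ⊎ Fin b → ℕ) →
            sum (h ∘ splitAt a) ≡ sum (h ∘ inj₁) + sum (h ∘ inj₂)
∑-splitAt zero    h = refl
∑-splitAt (suc a) h =
  trans (cong (h (inj₁ zero) +_) (∑-splitAt a (h ∘ Sum.map₁ suc))) (≡.sym (+-assoc (h (inj₁ zero)) _ _))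

∑-remQuot : ∀ a b (h : Fin a × Fin b → ℕ) →
            sum (h ∘ remQuot b) ≡ ∑[ i < a ] ∑[ j < b ] h (i , j)
∑-remQuot zero    b h = refl
∑-remQuot (suc a) b h =
  trans (∑-splitAt b (h ∘ Product.swap ∘ Sum.[ (_, zero) , Product.map₂ suc ∘ quotRem b ]′))
        (cong (∑[ j < b ] h (zero , j) +_) (∑-remQuot a b (h ∘ Product.map₁ suc)))

count-all : ∀ k → count {k} (λ _ → true) ≡ k
count-all zero    = refl
count-all (suc k) = cong suc (count-all k)

count-none : ∀ {k} {p : Fin k → Bool} → (∀ i → p i ≡ false) → count p ≡ 0
count-none p≡false = ∑-zero (cong indicator ∘ p≡false)

count-cong : ∀ {k} {p q : Fin k → Bool} → (∀ i → p i ≡ q i) → count p ≡ count q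
count-cong {k} p≡q = sum-cong-≗ {k} (cong indicator ∘ p≡q)

T⇒0<count : ∀ {k} (p : Fin k → Bool) i → T (p i) → 0 < count p
T⇒0<count p i _ with p i | term≤∑ (indicator ∘ p) i
... | true | 1≤count = 1≤count

length-filter-tabulate : ∀ {A : Set} {k} (p : A → Bool) (g : Fin k → A) →
                         length (filter (T? ∘ p) (tabulate g)) ≡ count (p ∘ g)
length-filter-tabulate {k = zero}  p g = refl
length-filter-tabulate {k = suc k} p g with p (g zero)
... | true  = cong suc (length-filter-tabulate p (g ∘ suc))
... | false = length-filter-tabulate p (g ∘ suc)

count-pigeonhole : ∀ {a b k} (R : Fin a → Fin b → Bool) →
                   (∀ i → 0 < count (R i)) → (∀ j → count (λ i → R i j) ≤ k) → a ≤ b * k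
count-pigeonhole {a} {b} {k} R covered bounded = begin
  a                                       ≡⟨ count-all a ⟨
  count {a} (λ _ → true)                  ≤⟨ ∑-mono-≤ covered ⟩
  ∑[ i < a ] ∑[ j < b ] indicator (R i j) ≡⟨ ∑-comm (λ i j → indicator (R i j)) ⟩
  ∑[ j < b ] ∑[ i < a ] indicator (R i j) ≤⟨ ∑-≤-* bounded ⟩
  b * k                                   ∎
  where open ≤-Reasoning

inInterval : ℕ → ℕ → ℕ → Bool
inInterval lo t x = (lo ≤ᵇ x) ∧ (x <ᵇ lo + t)

inInterval⁺ : ∀ {lo t x} → lo ≤ x → x < lo + t → T (inInterval lo t x)
inInterval⁺ lo≤x x<lo+t = Equivalence.from T-∧ (≤⇒≤ᵇ lo≤x , <⇒<ᵇ x<lo+t)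

inInterval⁻ : ∀ lo t x → T (inInterval lo t x) → lo ≤ x × x < lo + t
inInterval⁻ lo t x x∈ with Equivalence.to T-∧ x∈
... | lo≤ᵇx , x<ᵇlo+t = ≤ᵇ⇒≤ lo x lo≤ᵇx , <ᵇ⇒< x (lo + t) x<ᵇlo+t

inInterval-suc : ∀ lo t x → inInterval (suc lo) t (suc x) ≡ inInterval lo t x
inInterval-suc zero     t x = refl
inInterval-suc (suc lo) t x = refl

count-interval : ∀ {w} lo t → lo + t ≤ w → count {w} (λ u → inInterval lo t (toℕ u)) ≡ t
count-interval {zero}  zero     zero    _ = refl
count-interval {suc w} zero     zero    _ = count-none {w} (λ _ → refl)
count-interval {suc w} zero     (suc t) (s≤s t≤w) = cong suc (count-interval zero t t≤w)
count-interval {suc w} (suc lo) t       (s≤s lo+t≤w) =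
  trans (count-cong {w} (inInterval-suc lo t ∘ toℕ)) (count-interval lo t lo+t≤w)

count-interval-≤ : ∀ {w} lo t → count {w} (λ u → inInterval lo t (toℕ u)) ≤ t
count-interval-≤ {zero}  lo       t       = z≤n
count-interval-≤ {suc w} zero     zero    = ≤-reflexive (count-none {w} (λ _ → refl))
count-interval-≤ {suc w} zero     (suc t) = s≤s (count-interval-≤ {w} zero t)
count-interval-≤ {suc w} (suc lo) t       =
  ≤-trans (≤-reflexive (count-cong {w} (inInterval-suc lo t ∘ toℕ))) (count-interval-≤ {w} lo t)

interval-around : ∀ {u t w} → u < w → 0 < t → t ≤ w → ∃[ s ] s ≤ u × u < s + t × s + t ≤ w
interval-around {u} {t} {w} u<w 0<t t≤w with u + t ≤? w
... | yes u+t≤w = u , ≤-refl , m<m+n u 0<t , u+t≤w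
... | no  u+t≰w = w ∸ t
                , m≤n+o⇒m∸n≤o w t (subst (w ≤_) (+-comm u t) (<⇒≤ (≰⇒> u+t≰w)))
                , subst (u <_) (≡.sym (m∸n+n≡m t≤w)) u<w
                , ≤-reflexive (m∸n+n≡m t≤w)

outdeg : {G : Graph} → Orientation G → Fin (n G) → ℕ
outdeg D v = count (λ u → arc D v u)

degree : (G : Graph) → Fin (n G) → ℕ
degree G v = count (adj G v)

indeg≡count : ∀ {G} (D : Orientation G) v → indeg D v ≡ count (λ u → arc D u v)
indeg≡count D v = length-filter-tabulate (λ u → arc D u v) id

¬T⇒≡false : ∀ {b} → ¬ T b → b ≡ false
¬T⇒≡false {false} _  = refl
¬T⇒≡false {true}  ¬t = ⊥-elim (¬t _)

∨⇒xor : ∀ a b → (T a → ¬ T b) → T (a ∨ b) → T (a xor b)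
∨⇒xor true  true  a⇒¬b _   = a⇒¬b _ _
∨⇒xor true  false _    _   = _
∨⇒xor false _     _    a∨b = a∨b

indicator-xor : ∀ a b c → (T a → T c) → (T b → T c) → (T c → T (a xor b)) →
                indicator a + indicator b ≡ indicator c
indicator-xor true  true  true  _   _   c⇒a⊕b = ⊥-elim (c⇒a⊕b _)
indicator-xor true  true  false a⇒c _   _     = ⊥-elim (a⇒c _)
indicator-xor true  false true  _   _   _     = refl
indicator-xor true  false false a⇒c _   _     = ⊥-elim (a⇒c _)
indicator-xor false true  true  _   _   _     = refl
indicator-xor false true  false _   b⇒c _     = ⊥-elim (b⇒c _)
indicator-xor false false true  _   _   c⇒a⊕b = ⊥-elim (c⇒a⊕b _)
indicator-xor false false false _   _   _     = refl

outdeg+indeg≡degree : ∀ {G} (D : Orientation G) v → outdeg D v + indeg D v ≡ degree G v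
outdeg+indeg≡degree {G} D v = begin
  outdeg D v + indeg D v
    ≡⟨ cong (outdeg D v +_) (indeg≡count D v) ⟩
  count (λ u → arc D v u) + count (λ u → arc D u v)
    ≡⟨ ∑-distrib-+ (indicator ∘ arc D v) (λ u → indicator (arc D u v)) ⟨
  ∑[ u < n G ] (indicator (arc D v u) + indicator (arc D u v))
    ≡⟨ sum-cong-≗ {n G} arcs-of-an-edge ⟩
  degree G v ∎
  where
  open ≡-Reasoning
  arcs-of-an-edge : ∀ u → indicator (arc D v u) + indicator (arc D u v) ≡ indicator (adj G v u)
  arcs-of-an-edge u = indicator-xor _ _ _ (arc⇒adj D v u) (subst T (sym G u v) ∘ arc⇒adj D u v) (oneArc D v u)

colouring⇒¬HasClique : ∀ {G k} (colour : Fin (n G) → Fin k) →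
                       (∀ x y → T (adj G x y) → colour x ≢ colour y) → ¬ HasClique G (suc k)
colouring⇒¬HasClique colour proper (f , _ , f-adj) with pigeonhole (n<1+n _) (colour ∘ f)
... | i , j , i<j , same = proper (f i) (f j) (f-adj i j (Finₚ.<⇒≢ i<j)) same

gap-pigeonhole : ∀ {m} (d : Fin (suc m) → ℕ) →
                 (∀ i → d i ≡ 0 ⊎ m < d i) → (∀ i → d i < m + m) → ∃₂ λ i j → i ≢ j × d i ≡ d j
gap-pigeonhole {zero}  d _    d<2m = ⊥-elim (n≮0 (d<2m zero))
gap-pigeonhole {suc m} d gaps d<2m with pigeonhole (n<1+n (suc m)) shifted
  where
  shifted : Fin (suc (suc m)) → Fin (suc m)
  shifted i = fromℕ< (m<n+o⇒m∸n<o (d i) (suc m) (d<2m i))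
... | i , j , i<j , same = i , j , Finₚ.<⇒≢ i<j , ∸-injective-on-gaps (gaps i) (gaps j) ∸-equal
  where
  ∸-equal : d i ∸ suc m ≡ d j ∸ suc m
  ∸-equal = trans (≡.sym (toℕ-fromℕ< _)) (trans (cong toℕ same) (toℕ-fromℕ< _))
  ∸-injective-on-gaps : ∀ {x y} → x ≡ 0 ⊎ suc m < x → y ≡ 0 ⊎ suc m < y →
                        x ∸ suc m ≡ y ∸ suc m → x ≡ y
  ∸-injective-on-gaps (inj₁ refl) (inj₁ refl) _  = refl
  ∸-injective-on-gaps (inj₁ refl) (inj₂ m<y)  eq = ⊥-elim (<⇒≢ (m<n⇒0<n∸m m<y) eq)
  ∸-injective-on-gaps (inj₂ m<x)  (inj₁ refl) eq = ⊥-elim (<⇒≢ (m<n⇒0<n∸m m<x) (≡.sym eq))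
  ∸-injective-on-gaps (inj₂ m<x)  (inj₂ m<y)  eq = ∸-cancelʳ-≡ (<⇒≤ m<x) (<⇒≤ m<y) eq

module OrientedGraph {V : Set} {size : ℕ} (index : Fin size ↔ V)
                     (_⇒_ : V → V → Bool) (⇒-asym : ∀ a b → T (a ⇒ b) → ¬ T (b ⇒ a)) where

  open Inverse index public using (to; from)
  open Inverse index using () renaming (strictlyInverseˡ to to∘from; strictlyInverseʳ to from∘to)

  adjacent : V → V → Bool
  adjacent a b = (a ⇒ b) ∨ (b ⇒ a)

  ⇒-irrefl : ∀ a → (a ⇒ a) ≡ false
  ⇒-irrefl a = ¬T⇒≡false (λ a⇒a → ⇒-asym a a a⇒a a⇒a)

  graph : Graph
  graph = record
    { n      = size
    ; adj    = λ x y → adjacent (to x) (to y)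
    ; sym    = λ x y → ∨-comm (to x ⇒ to y) (to y ⇒ to x)
    ; irrefl = λ x → cong (λ b → b ∨ b) (⇒-irrefl (to x))
    }

  orientation : Orientation graph
  orientation = record
    { arc     = λ x y → to x ⇒ to y
    ; arc⇒adj = λ x y → Equivalence.from T-∨ ∘ inj₁
    ; oneArc  = λ x y → ∨⇒xor (to x ⇒ to y) (to y ⇒ to x) (⇒-asym (to x) (to y))
    }

  to-injective : ∀ {x y} → to x ≡ to y → x ≡ y
  to-injective {x} {y} eq = trans (≡.sym (from∘to x)) (trans (cong from eq) (from∘to y))

  from-injective : ∀ {a b} → from a ≡ from b → a ≡ b
  from-injective {a} {b} eq = trans (≡.sym (to∘from a)) (trans (cong to eq) (to∘from b))

  adj-from : ∀ a b → adj graph (from a) (from b) ≡ adjacent a b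
  adj-from a b = cong₂ adjacent (to∘from a) (to∘from b)

  adjacent⇒adj : ∀ a b → T (adjacent a b) → T (adj graph (from a) (from b))
  adjacent⇒adj a b = subst T (≡.sym (adj-from a b))

  degree-from : ∀ a → degree graph (from a) ≡ count (λ x → adjacent a (to x))
  degree-from a = count-cong {size} (λ x → cong (λ b → adjacent b (to x)) (to∘from a))

  adjacent⇒≢ : ∀ {A : Set} (f : V → A) → (∀ a b → T (a ⇒ b) → f a ≢ f b) →
               ∀ a b → T (adjacent a b) → f a ≢ f b
  adjacent⇒≢ f separates a b a~b with Equivalence.to T-∨ a~b
  ... | inj₁ a⇒b = separates a b a⇒b
  ... | inj₂ b⇒a = ≢-sym (separates b a b⇒a)

  module _ (D : Orientation graph) where

    arcᵛ : V → V → Bool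
    arcᵛ a b = arc D (from a) (from b)

    arcᵛ⇒adjacent : ∀ a b → T (arcᵛ a b) → T (adjacent a b)
    arcᵛ⇒adjacent a b = subst T (adj-from a b) ∘ arc⇒adj D (from a) (from b)

    arcᵛ-nonadjacent : ∀ a b → adjacent a b ≡ false → arcᵛ a b ≡ false
    arcᵛ-nonadjacent a b a≁b = ¬T⇒≡false (subst T a≁b ∘ arcᵛ⇒adjacent a b)

    indeg-from : ∀ b → indeg D (from b) ≡ count (λ x → arcᵛ (to x) b)
    indeg-from b = trans (indeg≡count D (from b))
                         (count-cong {size} (λ x → cong (λ y → arc D y (from b)) (≡.sym (from∘to x))))

    outdeg-from : ∀ a → outdeg D (from a) ≡ count (λ x → arcᵛ a (to x))
    outdeg-from a = count-cong {size} (λ x → cong (arc D (from a)) (≡.sym (from∘to x)))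

-- clique u is vᵤ; copy s t c is the c-th copy on the interval {vₛ, …, vₛ₊ₜ₋₁},
-- cut off at vₘ.
module Construction (m : ℕ) where

  ω N : ℕ
  ω = suc m
  N = suc (ω * (m + m))

  Vertex : Set
  Vertex = Fin ω ⊎ (Fin m ⊎ (Fin ω × Fin ω × Fin N))

  pattern clique u   = inj₁ u
  pattern booster r  = inj₂ (inj₁ r)
  pattern copy s t c = inj₂ (inj₂ (s , t , c))

  index : Fin (ω + (m + ω * (ω * N))) ↔ Vertex
  index = ↔-trans +↔⊎ (↔-refl ⊎-↔ ↔-trans +↔⊎ (↔-refl ⊎-↔ ↔-trans *↔× (↔-refl ×-↔ *↔×)))

  _⇒_ : Vertex → Vertex → Bool
  clique u  ⇒ clique v       = toℕ u <ᵇ toℕ v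
  clique u  ⇒ copy s t _     = inInterval (toℕ s) (toℕ t) (toℕ u)
  booster _ ⇒ clique (suc _) = true
  _         ⇒ _              = false

  ⇒-asym : ∀ a b → T (a ⇒ b) → ¬ T (b ⇒ a)
  ⇒-asym (clique u)   (clique v)       u<v v<u =
    <-asym (<ᵇ⇒< (toℕ u) (toℕ v) u<v) (<ᵇ⇒< (toℕ v) (toℕ u) v<u)
  ⇒-asym (clique _)   (copy _ _ _)     _   ()
  ⇒-asym (clique _)   (booster _)      ()
  ⇒-asym (booster _)  (clique zero)    ()
  ⇒-asym (booster _)  (clique (suc _)) _   ()
  ⇒-asym (booster _)  (inj₂ _)         ()
  ⇒-asym (copy _ _ _) _                ()

  open OrientedGraph index _⇒_ ⇒-asym public

  ∑-Vertex : (h : Vertex → ℕ) →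
             sum (h ∘ to) ≡
             sum (h ∘ clique) + (sum (h ∘ booster) + ∑[ s < ω ] ∑[ t < ω ] ∑[ c < N ] h (copy s t c))
  ∑-Vertex h = begin
    sum (h ∘ to)
      ≡⟨ ∑-splitAt ω (h ∘ Sum.map₂ (Sum.map₂ copies ∘ splitAt m)) ⟩
    sum (h ∘ clique) + sum (h ∘ inj₂ ∘ Sum.map₂ copies ∘ splitAt m)
      ≡⟨ cong (sum (h ∘ clique) +_) (∑-splitAt m (h ∘ inj₂ ∘ Sum.map₂ copies)) ⟩
    sum (h ∘ clique) + (sum (h ∘ booster) + sum (h ∘ inj₂ ∘ inj₂ ∘ copies))
      ≡⟨ cong (λ z → sum (h ∘ clique) + (sum (h ∘ booster) + z)) copies-sum ⟩
    sum (h ∘ clique) + (sum (h ∘ booster) + ∑[ s < ω ] ∑[ t < ω ] ∑[ c < N ] h (copy s t c)) ∎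
    where
    open ≡-Reasoning
    copies : Fin (ω * (ω * N)) → Fin ω × Fin ω × Fin N
    copies = Product.map₂ (remQuot N) ∘ remQuot (ω * N)
    copies-sum : sum (h ∘ inj₂ ∘ inj₂ ∘ copies) ≡ ∑[ s < ω ] ∑[ t < ω ] ∑[ c < N ] h (copy s t c)
    copies-sum = trans (∑-remQuot ω (ω * N) (h ∘ inj₂ ∘ inj₂ ∘ Product.map₂ (remQuot N)))
                       (sum-cong-≗ {ω} (λ s → ∑-remQuot ω N (λ (t , c) → h (copy s t c))))

  count-on-clique : (g : Vertex → Bool) →
                    (∀ r → g (booster r) ≡ false) → (∀ s t c → g (copy s t c) ≡ false) →
                    count (g ∘ to) ≡ count (g ∘ clique)
  count-on-clique g booster≡false copy≡false =
    trans (∑-Vertex (indicator ∘ g))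
          (trans (cong (count (g ∘ clique) +_)
                       (cong₂ _+_ (count-none booster≡false)
                                  (∑-zero λ s → ∑-zero λ t → count-none (copy≡false s t))))
                 (+-identityʳ _))

  count-copy≤ : (g : Vertex → Bool) (s t : Fin ω) → count (λ c → g (copy s t c)) ≤ count (g ∘ to)
  count-copy≤ g s t = begin
    count (λ c → g (copy s t c))
      ≤⟨ term≤∑ (λ t → count (λ c → g (copy s t c))) t ⟩
    ∑[ t < ω ] count (λ c → g (copy s t c))
      ≤⟨ term≤∑ (λ s → ∑[ t < ω ] count (λ c → g (copy s t c))) s ⟩
    ∑[ s < ω ] ∑[ t < ω ] count (λ c → g (copy s t c)) ≤⟨ m≤n+m _ (count (g ∘ booster)) ⟩
    count (g ∘ booster) + _                           ≤⟨ m≤n+m _ (count (g ∘ clique)) ⟩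
    count (g ∘ clique) + (count (g ∘ booster) + _)    ≡⟨ ∑-Vertex (indicator ∘ g) ⟨
    count (g ∘ to)                                    ∎
    where open ≤-Reasoning

  clique-adjacent : ∀ {u v} → u ≢ v → T (adjacent (clique u) (clique v))
  clique-adjacent {u} {v} u≢v with <-cmp (toℕ u) (toℕ v)
  ... | tri< u<v _ _ = Equivalence.from T-∨ (inj₁ (<⇒<ᵇ u<v))
  ... | tri≈ _ u≡v _ = ⊥-elim (u≢v (toℕ-injective u≡v))
  ... | tri> _ _ v<u = Equivalence.from T-∨ (inj₂ (<⇒<ᵇ v<u))

  isClique : Vertex → Bool
  isClique (clique _) = true
  isClique _          = false

  split : IsSplit graph
  split = isClique ∘ to
        , (λ x y x≢y → clique-side (to x) (to y) (x≢y ∘ to-injective))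
        , (λ x y → independent-side (to x) (to y))
    where
    clique-side : ∀ a b → a ≢ b → T (isClique a) → T (isClique b) → T (adjacent a b)
    clique-side (clique _) (clique _) a≢b _ _ = clique-adjacent (a≢b ∘ cong clique)
    clique-side (clique _) (inj₂ _)   _   _ ()
    clique-side (inj₂ _)   _          _   ()
    independent-side : ∀ a b → isClique a ≡ false → isClique b ≡ false → adjacent a b ≡ false
    independent-side (booster _)  (booster _)  _  _  = refl
    independent-side (booster _)  (copy _ _ _) _  _  = refl
    independent-side (copy _ _ _) (booster _)  _  _  = refl
    independent-side (copy _ _ _) (copy _ _ _) _  _  = refl
    independent-side (clique _)   _            () _
    independent-side (inj₂ _)     (clique _)   _  ()

  -- A copy on an interval starting at v₀ misses vₘ; any other copy misses v₀.
  colour : Vertex → Fin ω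
  colour (clique u)         = u
  colour (booster _)        = zero
  colour (copy zero _ _)    = fromℕ m
  colour (copy (suc _) _ _) = zero

  colour-⇒ : ∀ a b → T (a ⇒ b) → colour a ≢ colour b
  colour-⇒ (clique u)         (clique v)         u<v u≡v =
    <-irrefl (cong toℕ u≡v) (<ᵇ⇒< (toℕ u) (toℕ v) u<v)
  colour-⇒ (clique u)         (copy zero t _)    u∈I u≡m =
    <-irrefl (trans (cong toℕ u≡m) (toℕ-fromℕ m))
             (<-≤-trans (proj₂ (inInterval⁻ 0 (toℕ t) (toℕ u) u∈I)) (toℕ≤pred[n] t))
  colour-⇒ (clique zero)      (copy (suc _) _ _) ()
  colour-⇒ (clique (suc _))   (copy (suc _) _ _) _   ()
  colour-⇒ (clique _)         (booster _)        ()
  colour-⇒ (booster _)        (clique zero)      ()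
  colour-⇒ (booster _)        (clique (suc _))   _   ()
  colour-⇒ (booster _)        (inj₂ _)           ()
  colour-⇒ (copy _ _ _)       _                  ()

  cliqueNumber : CliqueNumber graph ω
  cliqueNumber = (from ∘ clique , inj₁-injective ∘ from-injective ,
                  λ i j → adjacent⇒adj (clique i) (clique j) ∘ clique-adjacent)
               , colouring⇒¬HasClique {graph} (colour ∘ to)
                                       (λ x y → adjacent⇒≢ colour colour-⇒ (to x) (to y))

  indeg₀ : Vertex → ℕ
  indeg₀ b = count (λ x → to x ⇒ b)

  indeg₀-clique : ∀ u → indeg₀ (clique u) ≡ toℕ u + count (λ r → booster r ⇒ clique u)
  indeg₀-clique u =
    trans (∑-Vertex (indicator ∘ (_⇒ clique u)))
          (cong₂ _+_ (count-interval 0 (toℕ u) (<⇒≤ (toℕ<n u)))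
                     (trans (cong (count (λ r → booster r ⇒ clique u) +_)
                                  (∑-zero {ω} λ _ → ∑-zero {ω} λ _ → count-none {N} λ _ → refl))
                            (+-identityʳ _)))

  indeg₀-v₀ : indeg₀ (clique zero) ≡ 0
  indeg₀-v₀ = trans (indeg₀-clique zero) (count-none {m} λ _ → refl)

  indeg₀-clique-suc : ∀ a → indeg₀ (clique (suc a)) ≡ suc (toℕ a) + m
  indeg₀-clique-suc a = trans (indeg₀-clique (suc a)) (cong (suc (toℕ a) +_) (count-all m))

  indeg₀-booster : ∀ r → indeg₀ (booster r) ≡ 0
  indeg₀-booster r =
    trans (count-on-clique (_⇒ booster r) (λ _ → refl) (λ _ _ _ → refl)) (count-none {ω} λ _ → refl)

  indeg₀-copy : ∀ s t c → indeg₀ (copy s t c) ≡ count {ω} (λ w → inInterval (toℕ s) (toℕ t) (toℕ w))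
  indeg₀-copy s t c = count-on-clique (_⇒ copy s t c) (λ _ → refl) (λ _ _ _ → refl)

  indeg₀-copy-≤ : ∀ s t c → indeg₀ (copy s t c) ≤ m
  indeg₀-copy-≤ s t c =
    subst (_≤ m) (≡.sym (indeg₀-copy s t c))
          (≤-trans (count-interval-≤ {ω} (toℕ s) (toℕ t)) (toℕ≤pred[n] t))

  indeg₀-≤ : ∀ a → indeg₀ a ≤ m + m
  indeg₀-≤ (clique zero)    = subst (_≤ m + m) (≡.sym indeg₀-v₀) z≤n
  indeg₀-≤ (clique (suc a)) = subst (_≤ m + m) (≡.sym (indeg₀-clique-suc a)) (+-monoˡ-≤ m (toℕ<n a))
  indeg₀-≤ (booster r)      = subst (_≤ m + m) (≡.sym (indeg₀-booster r)) z≤n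
  indeg₀-≤ (copy s t c)     = ≤-trans (indeg₀-copy-≤ s t c) (m≤m+n m m)

  indeg₀-clique-< : ∀ {u v} → toℕ u < toℕ v → indeg₀ (clique u) < indeg₀ (clique v)
  indeg₀-clique-< {zero}  {suc b} _ =
    subst₂ _<_ (≡.sym indeg₀-v₀) (≡.sym (indeg₀-clique-suc b)) z<s
  indeg₀-clique-< {suc a} {suc b} a<b =
    subst₂ _<_ (≡.sym (indeg₀-clique-suc a)) (≡.sym (indeg₀-clique-suc b)) (+-monoˡ-< m a<b)

  indeg₀-⇒ : ∀ a b → T (a ⇒ b) → indeg₀ a ≢ indeg₀ b
  indeg₀-⇒ (clique u) (clique v) u<v = <⇒≢ (indeg₀-clique-< (<ᵇ⇒< (toℕ u) (toℕ v) u<v))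
  indeg₀-⇒ (clique zero) (copy s t c) v₀∈I =
    <⇒≢ (subst₂ _<_ (≡.sym indeg₀-v₀) (≡.sym (indeg₀-copy s t c))
                (T⇒0<count {ω} (λ w → inInterval (toℕ s) (toℕ t) (toℕ w)) zero v₀∈I))
  indeg₀-⇒ (clique (suc a)) (copy s t c) _ =
    ≢-sym (<⇒≢ (≤-<-trans (indeg₀-copy-≤ s t c)
                          (subst (m <_) (≡.sym (indeg₀-clique-suc a)) (m<n+m m z<s))))
  indeg₀-⇒ (booster r) (clique (suc a)) _ eq
    with () ← trans (≡.sym (indeg₀-booster r)) (trans eq (indeg₀-clique-suc a))
  indeg₀-⇒ (clique _)   (booster _)    ()
  indeg₀-⇒ (booster _)  (clique zero)  ()
  indeg₀-⇒ (booster _)  (inj₂ _)       ()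
  indeg₀-⇒ (copy _ _ _) _              ()

  upperBound : HasProperKOrientation graph (m + m)
  upperBound = orientation
             , (λ x y x~y → adjacent⇒≢ indeg₀ indeg₀-⇒ (to x) (to y) x~y ∘ indeg-as-indeg₀ x y)
             , (λ x → subst (_≤ m + m) (≡.sym (indeg≡count orientation x)) (indeg₀-≤ (to x)))
    where
    indeg-as-indeg₀ : ∀ x y → indeg orientation x ≡ indeg orientation y → indeg₀ (to x) ≡ indeg₀ (to y)
    indeg-as-indeg₀ x y eq = trans (≡.sym (indeg≡count orientation x)) (trans eq (indeg≡count orientation y))

  module LowerBound {j} (j<2m : j < m + m) (D : Orientation graph)
                    (proper : ∀ x y → T (adj graph x y) → indeg D x ≢ indeg D y)
                    (bounded : ∀ x → indeg D x ≤ j) where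

    d : Fin ω → ℕ
    d u = indeg D (from (clique u))

    copy-degree : ∀ s t c → toℕ s + toℕ t ≤ ω → degree graph (from (copy s t c)) ≡ toℕ t
    copy-degree s t c fits =
      trans (degree-from (copy s t c))
            (trans (count-on-clique (adjacent (copy s t c)) (λ _ → refl) (λ _ _ _ → refl))
                   (count-interval (toℕ s) (toℕ t) fits))

    copy-outdeg : ∀ s t c → outdeg D (from (copy s t c)) ≡ count (λ w → arcᵛ D (copy s t c) (clique w))
    copy-outdeg s t c =
      trans (outdeg-from D (copy s t c))
            (count-on-clique (arcᵛ D (copy s t c)) (λ r → arcᵛ-nonadjacent D (copy s t c) (booster r) refl)
                          (λ s′ t′ c′ → arcᵛ-nonadjacent D (copy s t c) (copy s′ t′ c′) refl))

    arcs-from-copies-≤ : ∀ s t w → count (λ c → arcᵛ D (copy s t c) (clique w)) ≤ j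
    arcs-from-copies-≤ s t w =
      ≤-trans (count-copy≤ (λ a → arcᵛ D a (clique w)) s t)
              (subst (_≤ j) (indeg-from D (clique w)) (bounded (from (clique w))))

    no-small-indeg : ∀ u → 0 < d u → d u ≤ m → ⊥
    no-small-indeg u 0<t t≤m with interval-around (toℕ<n u) 0<t (m≤n⇒m≤1+n t≤m)
    ... | s , s≤u , u<s+t , s+t≤ω = <-irrefl refl (≤-trans N≤ωj (*-monoʳ-≤ ω (<⇒≤ j<2m)))
      where
      s<ω : s < ω
      s<ω = ≤-<-trans s≤u (toℕ<n u)

      sᶠ tᶠ : Fin ω
      sᶠ = fromℕ< s<ω
      tᶠ = fromℕ< (s≤s t≤m)

      s+t≡ : toℕ sᶠ + toℕ tᶠ ≡ s + d u
      s+t≡ = cong₂ _+_ (toℕ-fromℕ< s<ω) (toℕ-fromℕ< (s≤s t≤m))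

      u∈I : ∀ c → T (adjacent (clique u) (copy sᶠ tᶠ c))
      u∈I c = Equivalence.from T-∨ (inj₁ (inInterval⁺ (subst (_≤ toℕ u) (≡.sym (toℕ-fromℕ< s<ω)) s≤u)
                                                        (subst (toℕ u <_) (≡.sym s+t≡) u<s+t)))

      sink⇒indeg≡d : ∀ c → outdeg D (from (copy sᶠ tᶠ c)) ≡ 0 → indeg D (from (copy sᶠ tᶠ c)) ≡ d u
      sink⇒indeg≡d c out≡0 = begin
        indeg D x              ≡⟨ cong (_+ indeg D x) out≡0 ⟨
        outdeg D x + indeg D x ≡⟨ outdeg+indeg≡degree D x ⟩
        degree graph x         ≡⟨ copy-degree sᶠ tᶠ c (subst (_≤ ω) (≡.sym s+t≡) s+t≤ω) ⟩
        toℕ tᶠ                 ≡⟨ toℕ-fromℕ< (s≤s t≤m) ⟩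
        d u                    ∎
        where
        open ≡-Reasoning
        x = from (copy sᶠ tᶠ c)

      has-out-arc : ∀ c → 0 < count (λ w → arcᵛ D (copy sᶠ tᶠ c) (clique w))
      has-out-arc c = subst (0 <_) (copy-outdeg sᶠ tᶠ c) (n≢0⇒n>0 λ out≡0 →
        proper (from (clique u)) (from (copy sᶠ tᶠ c)) (adjacent⇒adj (clique u) (copy sᶠ tᶠ c) (u∈I c))
               (≡.sym (sink⇒indeg≡d c out≡0)))

      N≤ωj : N ≤ ω * j
      N≤ωj = count-pigeonhole (λ c w → arcᵛ D (copy sᶠ tᶠ c) (clique w))
                              has-out-arc (arcs-from-copies-≤ sᶠ tᶠ)

    indeg-gap : ∀ u → d u ≡ 0 ⊎ m < d u
    indeg-gap u with d u ≟ 0 | m <? d u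
    ... | yes du≡0 | _       = inj₁ du≡0
    ... | no  _    | yes m<du = inj₂ m<du
    ... | no  du≢0 | no  m≮du = ⊥-elim (no-small-indeg u (n≢0⇒n>0 du≢0) (≮⇒≥ m≮du))

    contradiction : ⊥
    contradiction with gap-pigeonhole d indeg-gap (λ u → ≤-<-trans (bounded _) j<2m)
    ... | u , v , u≢v , same =
      proper (from (clique u)) (from (clique v)) (adjacent⇒adj (clique u) (clique v) (clique-adjacent u≢v)) same

  lowerBound : ∀ j → j < m + m → ¬ HasProperKOrientation graph j
  lowerBound j j<2m (D , proper , bounded) = LowerBound.contradiction j<2m D proper bounded

theorem16 : (ω : ℕ) → 1 ≤ ω → Σ Graph (λ G → IsSplit G × CliqueNumber G ω
    × ProperOrientationNumber G (2 * ω ∸ 2))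
theorem16 (suc m) _ =
  graph , split , cliqueNumber , subst (ProperOrientationNumber graph) 2m≡2ω∸2 (upperBound , lowerBound)
  where
  open Construction m
  2m≡2ω∸2 : m + m ≡ 2 * suc m ∸ 2
  2m≡2ω∸2 = ≡.sym (trans (cong (_∸ 2) (*-suc 2 m)) (cong (m +_) (+-identityʳ m)))
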